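{- Let $p$ be an odd prime and $d\in\mathbb{F}_p$, $d\ne 0,1$. If $\left(\frac{d}{p}\right)=1$, then $|E_d| = |E_{d^{ -1}}|$. If $\left(\frac{d}{p}\right)=-1$, then $|E_d|+|E_{d^{ -1}}| = 2p+2$.
   Context: For $c\in\mathbb{F}_p^*$, $c\ne1$, $E_c$ denotes the Edwards curve $x^2+y^2=1+cx^2y^2$ over $\mathbb{F}_p$, and $|E_c|$ denotes its order, i.e. the number of affine solutions $(x,y)\in\mathbb{F}_p^2$. $\left(\frac{d}{p}\right)$ is the Legendre symbol. -}

module Defs where

open import Data.Nat using (ℕ; zero; suc; _+_; _*_; _≟_; NonZero)
open import Data.Nat.DivMod using (_%_)
open import Data.List using (List; []; _∷_; length; filter; upTo; concatMap; map)
open import Data.Bool.ListAction using (any)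
open import Data.Integer using (ℤ; +_; -[1+_])
open import Data.Product using (_×_; _,_)
open import Data.Bool using (Bool; true; false; if_then_else_)
open import Relation.Nullary.Decidable using (⌊_⌋)
open import Data.Bool.Properties using (T?)

-- Elements of F_p are represented by the residues 0,1,…,p-1 (natural numbers < p);
-- arithmetic is ℕ arithmetic followed by reduction mod p.

pairsF : ℕ → List (ℕ × ℕ)
pairsF p = concatMap (λ x → map (λ y → (x , y)) (upTo p)) (upTo p)

onEdwards : (p c : ℕ) .{{_ : NonZero p}} → ℕ × ℕ → Bool
onEdwards p c (x , y) =
  ⌊ (x * x + y * y) % p ≟ (1 + c * (x * x) * (y * y)) % p ⌋

edwardsOrder : (p c : ℕ) .{{_ : NonZero p}} → ℕ
edwardsOrder p c = length (filter (λ xy → T? (onEdwards p c xy)) (pairsF p))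

isSquareB : (p d : ℕ) .{{_ : NonZero p}} → Bool
isSquareB p d = any (λ x → ⌊ (x * x) % p ≟ d % p ⌋) (upTo p)

legendre : (p d : ℕ) .{{_ : NonZero p}} → ℤ
legendre p d with d % p
... | zero = + 0
... | suc _ = if isSquareB p d then + 1 else -[1+ 0 ]

-- Write |E_c| as the sum over x of the fibre count N_c(x) = #{y : (x, y) ∈ E_c}; on the line
-- through x the curve equation reads y² (c x² − 1) = x² − 1.
--
-- If d = a² is a square, (x, y) ↦ (a x, 1/y) is a bijection between the points of E_d and of
-- E_{1/d} with y ≠ 0, and on both curves the points with y = 0 are those with x² = 1.
-- Hence |E_d| = |E_{1/d}|.
--
-- If d is not a square, then d x² ≠ 1, so for x ≠ 0 the fibres N_d(x) and N_{1/d}(1/x) count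
-- the square roots of r = (x² − 1)/(d x² − 1) and of d r. At most one of r, d r is a nonzero
-- square, every element has at most two roots, and r ↦ d r permutes F_p while the root counts
-- add up to p; so each such pair of fibres has exactly 2 points. With 2 + 2 points on x = 0
-- this gives |E_d| + |E_{1/d}| = 2 (p − 1) + 4 = 2 p + 2.

module Submission where

open import Defs
import Algebra.Properties.CommutativeMonoid.Sum
open import Data.Bool using (Bool; true; false; T; if_then_else_; _∨_)
open import Data.Bool.Properties using (T-∨; T?)
open import Data.Fin using (Fin; toℕ; fromℕ<)
open import Data.Fin.Properties using (toℕ<n; toℕ-fromℕ<; toℕ-injective)
import Data.Fin.Permutation as Perm
open import Data.Integer as ℤ using (ℤ; +_; -[1+_]; ∣_∣; _%ℕ_; _/ℕ_)
open import Data.Integer.DivMod using (n%ℕd<d; a≡a%ℕn+[a/ℕn]*n)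
open import Data.Integer.Divisibility.Signed
open import Data.Integer.Properties as ℤ using (pos-+; pos-*)
open import Data.Integer.Tactic.RingSolver using (solve; solve-∀)
open import Data.List using (List; []; _∷_; _++_; length; filter; map; concatMap; applyUpTo; upTo)
open import Data.List.Properties using (filter-++; length-++; map-applyUpTo)
open import Data.List.Membership.Propositional using (find; lose)
open import Data.List.Membership.Propositional.Properties using (∈-upTo⁺; ∈-upTo⁻)
open import Data.List.Relation.Unary.Any.Properties using (any⁺; any⁻)
open import Data.Nat as ℕ using (ℕ; zero; suc; NonZero; _<_; _≤_; z≤n; s≤s; _<?_; _≟_; _≡ᵇ_)
open import Data.Nat.Coprimality using (prime⇒coprime; coprime-Bézout)
open import Data.Nat.DivMod using (_%_; m%n<n; m<n⇒m%n≡m)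
import Data.Nat.Divisibility as ℕ
open import Data.Nat.GCD using (module Bézout)
open import Data.Nat.Primality using (Prime; euclidsLemma; prime⇒nonTrivial)
import Data.Nat.Properties as ℕ
open import Data.Nat.Tactic.RingSolver as ℕ-Solver using ()
open import Data.Product using (∃; _×_; _,_; proj₁; proj₂)
open import Data.Sum as Sum using (_⊎_; inj₁; inj₂)
open import Function using (_∘_; id; const; _⇔_; mk⇔; Equivalence)
open import Relation.Nullary using (¬_; Dec; yes; no; contradiction)
open import Relation.Nullary.Decidable using (⌊_⌋; toWitness; fromWitness)
open import Relation.Binary.PropositionalEquality

module FiniteSums where

  open import Data.Nat using (_+_; _*_)

  module ∑ = Algebra.Properties.CommutativeMonoid.Sum ℕ.+-0-commutativeMonoid

  ∑< : ℕ → (ℕ → ℕ) → ℕ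
  ∑< n f = ∑.sum {n} (f ∘ toℕ)

  ∑<-cong : ∀ n {f g : ℕ → ℕ} → (∀ i → i < n → f i ≡ g i) → ∑< n f ≡ ∑< n g
  ∑<-cong n f≗g = ∑.sum-cong-≗ (λ i → f≗g (toℕ i) (toℕ<n i))

  ∑<-distrib-+ : ∀ n (f g : ℕ → ℕ) → ∑< n (λ i → f i + g i) ≡ ∑< n f + ∑< n g
  ∑<-distrib-+ n f g = ∑.∑-distrib-+ {n} (f ∘ toℕ) (g ∘ toℕ)

  ∑<-comm : ∀ m n (f : ℕ → ℕ → ℕ) →
            ∑< m (λ i → ∑< n (f i)) ≡ ∑< n (λ j → ∑< m (λ i → f i j))
  ∑<-comm m n f = ∑.∑-comm {m} {n} (λ i j → f (toℕ i) (toℕ j))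

  ∑<-const : ∀ n c → ∑< n (const c) ≡ n * c
  ∑<-const zero    c = refl
  ∑<-const (suc n) c = cong (_+_ c) (∑<-const n c)

  ∑<-mono-≤ : ∀ n {f g : ℕ → ℕ} → (∀ i → i < n → f i ≤ g i) → ∑< n f ≤ ∑< n g
  ∑<-mono-≤ zero    f≤g = z≤n
  ∑<-mono-≤ (suc n) f≤g =
    ℕ.+-mono-≤ (f≤g 0 (s≤s z≤n)) (∑<-mono-≤ n (λ i i<n → f≤g (suc i) (s≤s i<n)))

  ∑<-mono-≤-≡⇒≡ : ∀ n {f g : ℕ → ℕ} → (∀ i → i < n → f i ≤ g i) →
                  ∑< n f ≡ ∑< n g → ∀ i → i < n → f i ≡ g i
  ∑<-mono-≤-≡⇒≡ (suc n) {f} {g} f≤g ∑f≡∑g = pointwise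
    where
    f≤g⁺ : ∀ i → i < n → f (suc i) ≤ g (suc i)
    f≤g⁺ i i<n = f≤g (suc i) (s≤s i<n)
    f0≡g0 : f 0 ≡ g 0
    f0≡g0 = ℕ.≤-antisym (f≤g 0 (s≤s z≤n)) (ℕ.+-cancelʳ-≤ _ (g 0) (f 0)
      (ℕ.≤-trans (ℕ.≤-reflexive (sym ∑f≡∑g)) (ℕ.+-monoʳ-≤ (f 0) (∑<-mono-≤ n f≤g⁺))))
    ∑f⁺≡∑g⁺ : ∑< n (f ∘ suc) ≡ ∑< n (g ∘ suc)
    ∑f⁺≡∑g⁺ = ℕ.+-cancelˡ-≡ (f 0) _ _ (trans ∑f≡∑g (cong (_+ ∑< n (g ∘ suc)) (sym f0≡g0)))
    pointwise : ∀ i → i < suc n → f i ≡ g i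
    pointwise zero    _         = f0≡g0
    pointwise (suc i) (s≤s i<n) = ∑<-mono-≤-≡⇒≡ n f≤g⁺ ∑f⁺≡∑g⁺ i i<n

  ∑<-permute : ∀ n (f σ τ : ℕ → ℕ) →
               (∀ i → i < n → σ i < n) → (∀ i → i < n → τ i < n) →
               (∀ i → i < n → τ (σ i) ≡ i) → (∀ i → i < n → σ (τ i) ≡ i) →
               ∑< n (f ∘ σ) ≡ ∑< n f
  ∑<-permute n f σ τ σ< τ< τσ στ =
    trans (∑.sum-cong-≗ {n} (λ i → cong f (sym (toℕ-fromℕ< (σ< (toℕ i) (toℕ<n i))))))
          (sym (∑.∑-permute {n} {n} (f ∘ toℕ) π))
    where
    lift : (ρ : ℕ → ℕ) → (∀ i → i < n → ρ i < n) → Fin n → Fin n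
    lift ρ ρ< i = fromℕ< (ρ< (toℕ i) (toℕ<n i))
    lift-inverse : ∀ ρ ρ< κ κ< → (∀ i → i < n → ρ (κ i) ≡ i) →
                   ∀ i → lift ρ ρ< (lift κ κ< i) ≡ i
    lift-inverse ρ ρ< κ κ< ρκ i =
      toℕ-injective (trans (toℕ-fromℕ< _) (trans (cong ρ (toℕ-fromℕ< _)) (ρκ (toℕ i) (toℕ<n i))))
    π : Perm.Permutation n n
    π = Perm.permutation (lift σ σ<) (lift τ τ<)
          (lift-inverse σ σ< τ τ< στ) (lift-inverse τ τ< σ σ< τσ)

  ∑<-agree-off-0 : ∀ n (f g : ℕ → ℕ) → 0 < n → (∀ i → 0 < i → i < n → f i ≡ g i) →
                   ∑< n f + g 0 ≡ ∑< n g + f 0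
  ∑<-agree-off-0 (suc n) f g _ f≗g = begin
    f 0 + ∑< n (f ∘ suc) + g 0
      ≡⟨ cong (λ s → f 0 + s + g 0) (∑<-cong n (λ i i<n → f≗g (suc i) (s≤s z≤n) (s≤s i<n))) ⟩
    f 0 + ∑< n (g ∘ suc) + g 0
      ≡⟨ swap-ends (f 0) (∑< n (g ∘ suc)) (g 0) ⟩
    g 0 + ∑< n (g ∘ suc) + f 0 ∎
    where
    open ≡-Reasoning
    swap-ends : ∀ a s b → a + s + b ≡ b + s + a
    swap-ends = ℕ-Solver.solve-∀

  𝟙 : Bool → ℕ
  𝟙 b = if b then 1 else 0

  count : ℕ → (ℕ → Bool) → ℕ
  count n P = ∑< n (𝟙 ∘ P)

  𝟙-cong : ∀ {a b} → T a ⇔ T b → 𝟙 a ≡ 𝟙 b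
  𝟙-cong {false} {false} _   = refl
  𝟙-cong {false} {true}  a⇔b with () ← Equivalence.from a⇔b _
  𝟙-cong {true}  {false} a⇔b with () ← Equivalence.to a⇔b _
  𝟙-cong {true}  {true}  _   = refl

  count-cong : ∀ n {P Q : ℕ → Bool} → (∀ i → i < n → T (P i) ⇔ T (Q i)) → count n P ≡ count n Q
  count-cong n P⇔Q = ∑<-cong n (λ i i<n → 𝟙-cong (P⇔Q i i<n))

  count-mono : ∀ n {P Q : ℕ → Bool} → (∀ i → i < n → T (P i) → T (Q i)) → count n P ≤ count n Q
  count-mono n P⇒Q = ∑<-mono-≤ n (λ i i<n → 𝟙-mono (P⇒Q i i<n))
    where
    𝟙-mono : ∀ {a b} → (T a → T b) → 𝟙 a ≤ 𝟙 b
    𝟙-mono {false}         _ = z≤n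
    𝟙-mono {true}  {true}  _ = ℕ.≤-refl
    𝟙-mono {true}  {false} f with () ← f _

  count-∨ : ∀ n (P Q : ℕ → Bool) → count n (λ i → P i ∨ Q i) ≤ count n P + count n Q
  count-∨ n P Q = ℕ.≤-trans (∑<-mono-≤ n (λ i _ → 𝟙-∨ (P i) (Q i)))
                            (ℕ.≤-reflexive (∑<-distrib-+ n (𝟙 ∘ P) (𝟙 ∘ Q)))
    where
    𝟙-∨ : ∀ a b → 𝟙 (a ∨ b) ≤ 𝟙 a + 𝟙 b
    𝟙-∨ false _ = ℕ.≤-refl
    𝟙-∨ true  _ = s≤s z≤n

  count-const-false : ∀ n → count n (const false) ≡ 0
  count-const-false n = trans (∑<-const n 0) (ℕ.*-zeroʳ n)

  count-≡ᵇ : ∀ n u → u < n → count n (_≡ᵇ u) ≡ 1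
  count-≡ᵇ (suc n) zero    _         = cong suc (count-const-false n)
  count-≡ᵇ (suc n) (suc u) (s≤s u<n) = count-≡ᵇ n u u<n

  count-≡ᵇ-≤1 : ∀ n u → count n (_≡ᵇ u) ≤ 1
  count-≡ᵇ-≤1 zero    u       = z≤n
  count-≡ᵇ-≤1 (suc n) zero    = ℕ.≤-reflexive (cong suc (count-const-false n))
  count-≡ᵇ-≤1 (suc n) (suc u) = count-≡ᵇ-≤1 n u

  count≤1 : ∀ n (P : ℕ → Bool) u → (∀ i → i < n → T (P i) → i ≡ u) → count n P ≤ 1
  count≤1 n P u P⇒≡u =
    ℕ.≤-trans (count-mono n (λ i i<n Pi → ℕ.≡⇒≡ᵇ i u (P⇒≡u i i<n Pi))) (count-≡ᵇ-≤1 n u)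

  count≤2 : ∀ n (P : ℕ → Bool) u v → (∀ i → i < n → T (P i) → i ≡ u ⊎ i ≡ v) → count n P ≤ 2
  count≤2 n P u v P⇒≡u⊎v = begin
    count n P
      ≤⟨ count-mono n (λ i i<n → Equivalence.from T-∨ ∘ ≡ᵇ⊎≡ᵇ ∘ P⇒≡u⊎v i i<n) ⟩
    count n (λ i → (i ≡ᵇ u) ∨ (i ≡ᵇ v))
      ≤⟨ count-∨ n (_≡ᵇ u) (_≡ᵇ v) ⟩
    count n (_≡ᵇ u) + count n (_≡ᵇ v)
      ≤⟨ ℕ.+-mono-≤ (count-≡ᵇ-≤1 n u) (count-≡ᵇ-≤1 n v) ⟩
    2 ∎
    where
    open ℕ.≤-Reasoning
    ≡ᵇ⊎≡ᵇ : ∀ {i} → i ≡ u ⊎ i ≡ v → T (i ≡ᵇ u) ⊎ T (i ≡ᵇ v)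
    ≡ᵇ⊎≡ᵇ {i} = Sum.[ inj₁ ∘ ℕ.≡⇒≡ᵇ i u , inj₂ ∘ ℕ.≡⇒≡ᵇ i v ]

  count≡0⊎witness : ∀ n (P : ℕ → Bool) → count n P ≡ 0 ⊎ ∃ λ i → i < n × T (P i)
  count≡0⊎witness zero    P = inj₁ refl
  count≡0⊎witness (suc n) P with P 0 in P0
  ... | true  = inj₂ (0 , s≤s z≤n , subst T (sym P0) _)
  ... | false = Sum.map id (λ (i , i<n , Pi) → suc i , s≤s i<n , Pi) (count≡0⊎witness n (P ∘ suc))

  length-filter-applyUpTo : ∀ {A : Set} (b : A → Bool) (g : ℕ → A) n →
                            length (filter (T? ∘ b) (applyUpTo g n)) ≡ count n (b ∘ g)
  length-filter-applyUpTo b g zero = refl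
  length-filter-applyUpTo b g (suc n) with b (g 0)
  ... | true  = cong suc (length-filter-applyUpTo b (g ∘ suc) n)
  ... | false = length-filter-applyUpTo b (g ∘ suc) n

  length-filter-grid : ∀ (b : ℕ × ℕ → Bool) m (g : ℕ → ℕ) n →
    length (filter (T? ∘ b) (concatMap (λ x → map (λ y → (x , y)) (upTo m)) (applyUpTo g n)))
      ≡ ∑< n (λ i → count m (λ y → b (g i , y)))
  length-filter-grid b m g zero    = refl
  length-filter-grid b m g (suc n) = begin
    length (filter b? (row (g 0) ++ rest))
      ≡⟨ cong length (filter-++ b? (row (g 0)) rest) ⟩
    length (filter b? (row (g 0)) ++ filter b? rest)
      ≡⟨ length-++ (filter b? (row (g 0))) ⟩
    length (filter b? (row (g 0))) + length (filter b? rest)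
      ≡⟨ cong₂ _+_ first-row (length-filter-grid b m (g ∘ suc) n) ⟩
    count m (λ y → b (g 0 , y)) + ∑< n (λ i → count m (λ y → b (g (suc i) , y))) ∎
    where
    open ≡-Reasoning
    b? : ∀ xy → Dec (T (b xy))
    b? = T? ∘ b
    row : ℕ → List (ℕ × ℕ)
    row x = map (λ y → (x , y)) (upTo m)
    rest : List (ℕ × ℕ)
    rest = concatMap row (applyUpTo (g ∘ suc) n)
    first-row : length (filter b? (row (g 0))) ≡ count m (λ y → b (g 0 , y))
    first-row = trans (cong (length ∘ filter b?) (map-applyUpTo id (λ y → (g 0 , y)) m))
                      (length-filter-applyUpTo b (λ y → (g 0 , y)) m)

open FiniteSums

module Congruence (m : ℤ) where

  open import Data.Integer using (_+_; _*_; -_; _-_)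

  -- a ≈ b is witnessed by m ∣ d together with the ring identity a − b ≡ d. As ≈-by is a
  -- constructor, a and b are known when that identity is elaborated, so the ring solver can
  -- prove it. The lemmas below are therefore certificates: d is a combination
  -- c₁ · h₁ ⊕ c₂ · h₂ ⊕ … of hypotheses hᵢ : aᵢ ≈ bᵢ, and solve checks
  -- a − b = Σ cᵢ (aᵢ − bᵢ).
  infix 4 _≈_
  data _≈_ (a b : ℤ) : Set where
    ≈-by : ∀ {d} → m ∣ d → a - b ≡ d → a ≈ b

  ‹_› : ∀ {a b} → a ≈ b → m ∣ a - b
  ‹ ≈-by m∣d refl › = m∣d

  infixl 4 _⊕_
  infixr 5 _·_

  _·_ : ∀ c {a b} → a ≈ b → m ∣ c * (a - b)
  c · a≈b = ∣n⇒∣m*n c ‹ a≈b ›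

  _⊕_ : ∀ {d e} → m ∣ d → m ∣ e → m ∣ d + e
  _⊕_ = ∣m∣n⇒∣m+n

  ≈-refl : ∀ {a} → a ≈ a
  ≈-refl {a} = ≈-by (divides (+ 0) refl) (ℤ.+-inverseʳ a)

  ≡⇒≈ : ∀ {a b} → a ≡ b → a ≈ b
  ≡⇒≈ refl = ≈-refl

  ≡+multiple⇒≈ : ∀ {a b} q → a ≡ b + q * m → a ≈ b
  ≡+multiple⇒≈ {b = b} q refl = ≈-by (divides q refl) (solve (b ∷ q ∷ m ∷ []))

  ≈-sym : ∀ {a b} → a ≈ b → b ≈ a
  ≈-sym {a} {b} a≈b = ≈-by (- + 1 · a≈b) (solve (a ∷ b ∷ []))

  ≈-trans : ∀ {a b c} → a ≈ b → b ≈ c → a ≈ c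
  ≈-trans {a} {b} {c} a≈b b≈c = ≈-by (‹ a≈b › ⊕ ‹ b≈c ›) (solve (a ∷ b ∷ c ∷ []))

  ≈-* : ∀ {a b c d} → a ≈ b → c ≈ d → a * c ≈ b * d
  ≈-* {a} {b} {c} {d} a≈b c≈d = ≈-by (c · a≈b ⊕ b · c≈d) (solve (a ∷ b ∷ c ∷ d ∷ []))

  a-b≈0⇒a≈b : ∀ a b → a - b ≈ + 0 → a ≈ b
  a-b≈0⇒a≈b a b h = ≈-by ‹ h › (solve (a ∷ b ∷ []))

  a+b≈0⇒a≈-b : ∀ a b → a + b ≈ + 0 → a ≈ - b
  a+b≈0⇒a≈-b a b h = ≈-by ‹ h › (solve (a ∷ b ∷ []))

  difference-of-squares : ∀ z y → z * z ≈ y * y → (z - y) * (z + y) ≈ + 0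
  difference-of-squares z y h = ≈-by ‹ h › (solve (y ∷ z ∷ []))

  unit-cancel : ∀ a b r → a * b ≈ + 1 → b * (a * r) ≈ r
  unit-cancel a b r ab≈1 = ≈-by (r · ab≈1) (solve (a ∷ b ∷ r ∷ []))

  inverse-unique : ∀ u v w → u * v ≈ + 1 → v * w ≈ + 1 → w ≈ u
  inverse-unique u v w uv≈1 vw≈1 = ≈-by (u · vw≈1 ⊕ - w · uv≈1) (solve (u ∷ v ∷ w ∷ []))

  ratio-square : ∀ d r t y i → t * t ≈ d * r → y * y ≈ r → y * i ≈ + 1 → (t * i) * (t * i) ≈ d
  ratio-square d r t y i t²≈dr y²≈r yi≈1 =
    ≈-by (i * i · t²≈dr ⊕ - (d * (i * i)) · y²≈r ⊕ d * (y * i + + 1) · yi≈1)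
         (solve (d ∷ r ∷ t ∷ y ∷ i ∷ []))

  [dx²≈1]⇒[x⁻¹]²≈d : ∀ d x s → d * (x * x) - + 1 ≈ + 0 → x * s ≈ + 1 → s * s ≈ d
  [dx²≈1]⇒[x⁻¹]²≈d d x s dx²≈1 xs≈1 =
    ≈-by (- (s * s) · dx²≈1 ⊕ d * (x * s + + 1) · xs≈1) (solve (d ∷ x ∷ s ∷ []))

  root-inverse : ∀ a d e → a * a ≈ d → d * e ≈ + 1 → a * (a * e) ≈ + 1
  root-inverse a d e a²≈d de≈1 = ≈-by (e · a²≈d ⊕ ‹ de≈1 ›) (solve (a ∷ d ∷ e ∷ []))

  root-inverse-square : ∀ a d e → a * a ≈ d → d * e ≈ + 1 → (a * e) * (a * e) ≈ e
  root-inverse-square a d e a²≈d de≈1 = ≈-by (e * e · a²≈d ⊕ e · de≈1) (solve (a ∷ d ∷ e ∷ []))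

module EdwardsAlgebra (m : ℤ) where

  open import Data.Integer using (_+_; _*_; -_; _-_)
  open Congruence m

  IsEdwardsPoint : ℤ → ℤ → ℤ → Set
  IsEdwardsPoint c x y = x * x + y * y ≈ + 1 + c * (x * x) * (y * y)

  edwards-swap : ∀ c x y → IsEdwardsPoint c x y → IsEdwardsPoint c y x
  edwards-swap c x y E = ≈-by ‹ E › (solve (c ∷ x ∷ y ∷ []))

  edwards-y≡0⇒x²≈1 : ∀ c x → IsEdwardsPoint c x (+ 0) → x * x ≈ + 1
  edwards-y≡0⇒x²≈1 c x E = ≈-by ‹ E › (solve (c ∷ x ∷ []))

  x²≈1⇒edwards-y≡0 : ∀ c x → x * x ≈ + 1 → IsEdwardsPoint c x (+ 0)
  x²≈1⇒edwards-y≡0 c x x²≈1 = ≈-by ‹ x²≈1 › (solve (c ∷ x ∷ []))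

  edwards⇒fibre-equation : ∀ d x y → IsEdwardsPoint d x y → y * y * (d * (x * x) - + 1) ≈ x * x - + 1
  edwards⇒fibre-equation d x y E = ≈-by ‹ ≈-sym E › (solve (d ∷ x ∷ y ∷ []))

  fibre-equation⇒edwards : ∀ d x y → y * y * (d * (x * x) - + 1) ≈ x * x - + 1 → IsEdwardsPoint d x y
  fibre-equation⇒edwards d x y L = ≈-by ‹ ≈-sym L › (solve (d ∷ x ∷ y ∷ []))

  edwards-inverse⇒fibre-equation : ∀ d e x s t → x * s ≈ + 1 → d * e ≈ + 1 →
    IsEdwardsPoint e s t → t * t * (d * (x * x) - + 1) ≈ d * (x * x - + 1)
  edwards-inverse⇒fibre-equation d e x s t xs≈1 de≈1 E =
    ≈-by (d * (x * x) · E ⊕ - ((d - t * t) * (x * s + + 1)) · xs≈1 ⊕ x * x * (s * s) * (t * t) · de≈1)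
         (solve (d ∷ e ∷ x ∷ s ∷ t ∷ []))

  fibre-equation⇒edwards-inverse : ∀ d e x s t → x * s ≈ + 1 → d * e ≈ + 1 →
    t * t * (d * (x * x) - + 1) ≈ d * (x * x - + 1) → IsEdwardsPoint e s t
  fibre-equation⇒edwards-inverse d e x s t xs≈1 de≈1 L =
    ≈-by (e * (s * s) · L ⊕ - ((t * t - + 1) * (x * s + + 1)) · xs≈1
          ⊕ - (x * x * (s * s) * (t * t) - x * x * (s * s) + s * s) · de≈1)
         (solve (d ∷ e ∷ x ∷ s ∷ t ∷ []))

  *≈⇒≈*inverse : ∀ c i z k → c * i ≈ + 1 → z * c ≈ k → z ≈ k * i
  *≈⇒≈*inverse c i z k ci≈1 zc≈k = ≈-by (- z · ci≈1 ⊕ i · zc≈k) (solve (c ∷ i ∷ z ∷ k ∷ []))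

  ≈*inverse⇒*≈ : ∀ c i z k → c * i ≈ + 1 → z ≈ k * i → z * c ≈ k
  ≈*inverse⇒*≈ c i z k ci≈1 z≈ki = ≈-by (c · z≈ki ⊕ k · ci≈1) (solve (c ∷ i ∷ z ∷ k ∷ []))

  edwards-twist : ∀ d e a x y s t → d * e ≈ + 1 → a * a ≈ d → s ≈ a * x → t * y ≈ + 1 →
    IsEdwardsPoint d x y → IsEdwardsPoint e s t
  edwards-twist d e a x y s t de≈1 a²≈d s≈ax ty≈1 E =
    ≈-by (- (t * t) · E ⊕ (t * y + + 1) * (+ 1 - d * (x * x)) · ty≈1 ⊕ - (x * x * (t * t)) · de≈1
          ⊕ x * x * (+ 1 - e * (t * t)) · a²≈d ⊕ (s + a * x) * (+ 1 - e * (t * t)) · s≈ax)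
         (solve (d ∷ e ∷ a ∷ x ∷ y ∷ s ∷ t ∷ []))

module Residues (p : ℕ) .{{_ : NonZero p}} (p-prime : Prime p) where

  open import Data.Integer using (_+_; _*_; -_; _-_)

  open Congruence (+ p) public

  1<p : 1 < p
  1<p = ℕ.nonTrivial⇒n>1 p {{prime⇒nonTrivial p-prime}}

  0<p : 0 < p
  0<p = ℕ.<-trans (s≤s z≤n) 1<p

  residue : ℤ → ℕ
  residue z = z %ℕ p

  residue<p : ∀ z → residue z < p
  residue<p z = n%ℕd<d z p

  residue-≈ : ∀ z → + residue z ≈ z
  residue-≈ z = ≈-sym (≡+multiple⇒≈ (z /ℕ p) (a≡a%ℕn+[a/ℕn]*n z p))

  residue-unique : ∀ {a b} → a < p → b < p → + a ≈ + b → a ≡ b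
  residue-unique {a} {b} a<p b<p a≈b =
    ℤ.+-injective (ℤ.i-j≡0⇒i≡j (+ a) (+ b)
      (ℤ.∣i∣≡0⇒i≡0 (below-p ∣ + a - + b ∣ (∣⇒∣ᵤ ‹ a≈b ›) distance<p)))
    where
    distance<p : ∣ + a - + b ∣ < p
    distance<p = ℕ.≤-<-trans (ℕ.≤-reflexive (cong ∣_∣ (ℤ.[+m]-[+n]≡m⊖n a b)))
                   (ℕ.≤-<-trans (ℤ.∣m⊝n∣≤m⊔n a b) (ℕ.⊔-lub a<p b<p))
    below-p : ∀ n → p ℕ.∣ n → n < p → n ≡ 0
    below-p zero    _   _   = refl
    below-p (suc n) p∣n n<p = contradiction p∣n (ℕ.>⇒∤ n<p)

  T-%≟%⇔≈ : ∀ a b → T ⌊ a % p ≟ b % p ⌋ ⇔ + a ≈ + b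
  T-%≟%⇔≈ a b = mk⇔
    (λ t → ≈-trans (≈-sym (residue-≈ (+ a)))
             (≈-trans (≡⇒≈ (cong +_ (toWitness t))) (residue-≈ (+ b))))
    (λ a≈b → fromWitness (residue-unique (residue<p (+ a)) (residue<p (+ b))
      (≈-trans (residue-≈ (+ a)) (≈-trans a≈b (≈-sym (residue-≈ (+ b)))))))

  *%≡1⇒*≈1 : ∀ d e → (d ℕ.* e) % p ≡ 1 → + d * + e ≈ + 1
  *%≡1⇒*≈1 d e de%p≡1 = ≈-trans (≡⇒≈ (sym (pos-* d e)))
    (≈-trans (≈-sym (residue-≈ (+ (d ℕ.* e)))) (≡⇒≈ (cong +_ de%p≡1)))

  *≈0⇒≈0⊎≈0 : ∀ a b → a * b ≈ + 0 → a ≈ + 0 ⊎ b ≈ + 0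
  *≈0⇒≈0⊎≈0 a b ab≈0 = Sum.map (∣-zero a) (∣-zero b)
    (euclidsLemma ∣ a ∣ ∣ b ∣ p-prime (subst (p ℕ.∣_) (ℤ.abs-* a b) (∣⇒∣ᵤ p∣ab)))
    where
    p∣ab : + p ∣ a * b
    p∣ab = subst (+ p ∣_) (ℤ.+-identityʳ (a * b)) ‹ ab≈0 ›
    ∣-zero : ∀ z → p ℕ.∣ ∣ z ∣ → z ≈ + 0
    ∣-zero z p∣z = ≈-by (∣ᵤ⇒∣ p∣z) (ℤ.+-identityʳ z)

  same-square⇒≈± : ∀ z y → z * z ≈ y * y → z ≈ y ⊎ z ≈ - y
  same-square⇒≈± z y z²≈y² = Sum.map (a-b≈0⇒a≈b z y) (a+b≈0⇒a≈-b z y)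
    (*≈0⇒≈0⊎≈0 (z - y) (z + y) (difference-of-squares z y z²≈y²))

  pos-[c+a*m≡b*n] : ∀ c a m b n → c ℕ.+ a ℕ.* m ≡ b ℕ.* n → + c + + a * + m ≡ + b * + n
  pos-[c+a*m≡b*n] c a m b n eq = begin
    + c + + a * + m    ≡⟨ cong (_+_ (+ c)) (sym (pos-* a m)) ⟩
    + c + + (a ℕ.* m)  ≡⟨ sym (pos-+ c (a ℕ.* m)) ⟩
    + (c ℕ.+ a ℕ.* m)  ≡⟨ cong +_ eq ⟩
    + (b ℕ.* n)        ≡⟨ pos-* b n ⟩
    + b * + n          ∎
    where open ≡-Reasoning

  inverse-exists : ∀ x → 0 < x → x < p → ∃ λ y → y < p × + x * + y ≈ + 1
  inverse-exists x 0<x x<p with coprime-Bézout (prime⇒coprime p-prime {{ℕ.>-nonZero 0<x}} x<p)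
  ... | Bézout.-+ a b 1+ap≡bx = residue (+ b) , residue<p (+ b) ,
        ≈-trans (≈-* (≈-refl {+ x}) (residue-≈ (+ b))) (≡+multiple⇒≈ (+ a) (begin
          + x * + b          ≡⟨ ℤ.*-comm (+ x) (+ b) ⟩
          + b * + x          ≡⟨ sym (pos-[c+a*m≡b*n] 1 a p b x 1+ap≡bx) ⟩
          + 1 + + a * + p    ∎))
    where open ≡-Reasoning
  ... | Bézout.+- a b 1+bx≡ap = residue (- + b) , residue<p (- + b) ,
        ≈-trans (≈-* (≈-refl {+ x}) (residue-≈ (- + b))) (≡+multiple⇒≈ (- + a) (begin
          + x * - + b                ≡⟨ negate (+ x) (+ b) ⟩
          + 1 + - (+ 1 + + b * + x)  ≡⟨ cong (λ z → + 1 + - z) (pos-[c+a*m≡b*n] 1 b x a p 1+bx≡ap) ⟩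
          + 1 + - (+ a * + p)        ≡⟨ negate-multiple (+ a) (+ p) ⟩
          + 1 + - + a * + p          ∎))
    where
    open ≡-Reasoning
    negate : ∀ x b → x * - b ≡ + 1 + - (+ 1 + b * x)
    negate = solve-∀
    negate-multiple : ∀ a p → + 1 + - (a * p) ≡ + 1 + - a * p
    negate-multiple = solve-∀

  -- inv 0 reduces to 0; the fibre sums below use this definitionally when they reindex by inv.
  inv : ℕ → ℕ
  inv zero        = 0
  inv x@(suc _) with x <? p
  ... | yes x<p = proj₁ (inverse-exists x (s≤s z≤n) x<p)
  ... | no  _   = 0

  inv<p : ∀ x → inv x < p
  inv<p zero          = 0<p
  inv<p x@(suc _) with x <? p
  ... | yes x<p = proj₁ (proj₂ (inverse-exists x (s≤s z≤n) x<p))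
  ... | no  _   = 0<p

  *-inv : ∀ x → 0 < x → x < p → + x * + inv x ≈ + 1
  *-inv x@(suc _) _ x<p with x <? p
  ... | yes x<p = proj₂ (proj₂ (inverse-exists x (s≤s z≤n) x<p))
  ... | no  x≮p = contradiction x<p x≮p

  inv-positive : ∀ x → 0 < x → x < p → 0 < inv x
  inv-positive x 0<x x<p = ℕ.n≢0⇒n>0 λ inv≡0 → contradiction
    (residue-unique 1<p 0<p (≈-trans (≈-sym (*-inv x 0<x x<p))
      (≡⇒≈ (trans (cong (λ y → + x * + y) inv≡0) (ℤ.*-zeroʳ (+ x))))))
    (λ ())

  inv-involutive : ∀ x → x < p → inv (inv x) ≡ x
  inv-involutive zero      _   = refl
  inv-involutive x@(suc _) x<p = residue-unique (inv<p (inv x)) x<p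
    (inverse-unique (+ x) (+ inv x) (+ inv (inv x)) (*-inv x (s≤s z≤n) x<p)
      (*-inv (inv x) (inv-positive x (s≤s z≤n) x<p) (inv<p x)))

  ∑<-inv : ∀ f → ∑< p (f ∘ inv) ≡ ∑< p f
  ∑<-inv f = ∑<-permute p f inv inv (λ i _ → inv<p i) (λ i _ → inv<p i) inv-involutive inv-involutive

  scale : ℕ → ℕ → ℕ
  scale a r = residue (+ a * + r)

  scale<p : ∀ a r → scale a r < p
  scale<p a r = residue<p (+ a * + r)

  scale-≈ : ∀ a r → + scale a r ≈ + a * + r
  scale-≈ a r = residue-≈ (+ a * + r)

  scale-inverse : ∀ a b → + a * + b ≈ + 1 → ∀ r → r < p → scale b (scale a r) ≡ r
  scale-inverse a b ab≈1 r r<p = residue-unique (scale<p b (scale a r)) r<p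
    (≈-trans (scale-≈ b (scale a r))
      (≈-trans (≈-* (≈-refl {+ b}) (scale-≈ a r)) (unit-cancel (+ a) (+ b) (+ r) ab≈1)))

  ∑<-scale : ∀ a b → + a * + b ≈ + 1 → ∀ f → ∑< p (f ∘ scale a) ≡ ∑< p f
  ∑<-scale a b ab≈1 f =
    ∑<-permute p f (scale a) (scale b) (λ r _ → scale<p a r) (λ r _ → scale<p b r)
      (scale-inverse a b ab≈1) (scale-inverse b a (≈-trans (≡⇒≈ (ℤ.*-comm (+ b) (+ a))) ab≈1))

module EdwardsCurves (p : ℕ) .{{_ : NonZero p}} (p-prime : Prime p) where

  open import Data.Integer using (_+_; _*_; -_; _-_)

  open Residues p p-prime public
  open EdwardsAlgebra (+ p) public

  IsSquare : ℤ → Set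
  IsSquare z = ∃ λ a → a < p × + a * + a ≈ z

  T-square⇔ : ∀ y r → T ⌊ (y ℕ.* y) % p ≟ r % p ⌋ ⇔ + y * + y ≈ + r
  T-square⇔ y r =
    subst (λ z → T ⌊ (y ℕ.* y) % p ≟ r % p ⌋ ⇔ z ≈ + r) (pos-* y y) (T-%≟%⇔≈ (y ℕ.* y) r)

  T-isSquareB⇔IsSquare : ∀ d → T (isSquareB p d) ⇔ IsSquare (+ d)
  T-isSquareB⇔IsSquare d = mk⇔ to from
    where
    to : T (isSquareB p d) → IsSquare (+ d)
    to t with a , a∈upTo , root ← find (any⁻ _ (upTo p) t) =
      a , ∈-upTo⁻ a∈upTo , Equivalence.to (T-square⇔ a d) root
    from : IsSquare (+ d) → T (isSquareB p d)
    from (a , a<p , a²≈d) = any⁺ _ (lose (∈-upTo⁺ a<p) (Equivalence.from (T-square⇔ a d) a²≈d))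

  legendre≡1⇒square : ∀ d → legendre p d ≡ + 1 → IsSquare (+ d)
  legendre≡1⇒square d with d % p
  ... | zero  = λ ()
  ... | suc _ = Equivalence.to (T-isSquareB⇔IsSquare d) ∘ if≡1⇒T
    where
    if≡1⇒T : ∀ {b} → (if b then + 1 else -[1+ 0 ]) ≡ + 1 → T b
    if≡1⇒T {true} _ = _

  legendre≡-1⇒nonsquare : ∀ d → legendre p d ≡ -[1+ 0 ] → ¬ IsSquare (+ d)
  legendre≡-1⇒nonsquare d with d % p
  ... | zero  = λ ()
  ... | suc _ = λ symbol≡-1 → if≡-1⇒¬T symbol≡-1 ∘ Equivalence.from (T-isSquareB⇔IsSquare d)
    where
    if≡-1⇒¬T : ∀ {b} → (if b then + 1 else -[1+ 0 ]) ≡ -[1+ 0 ] → ¬ T b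
    if≡-1⇒¬T {false} _ ()

  isSqrtOf : ℕ → ℕ → Bool
  isSqrtOf r y = ⌊ (y ℕ.* y) % p ≟ r % p ⌋

  sqrtCount : ℕ → ℕ
  sqrtCount r = count p (isSqrtOf r)

  sqrtCount≤2 : ∀ r → sqrtCount r ≤ 2
  sqrtCount≤2 r with count≡0⊎witness p (isSqrtOf r)
  ... | inj₁ none = subst (_≤ 2) (sym none) z≤n
  ... | inj₂ (y , y<p , y-root) = count≤2 p (isSqrtOf r) y (residue (- + y)) ±y
    where
    ±y : ∀ z → z < p → T (isSqrtOf r z) → z ≡ y ⊎ z ≡ residue (- + y)
    ±y z z<p z-root = Sum.map (residue-unique z<p y<p)
      (λ z≈-y → residue-unique z<p (residue<p (- + y)) (≈-trans z≈-y (≈-sym (residue-≈ (- + y)))))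
      (same-square⇒≈± (+ z) (+ y)
        (≈-trans (Equivalence.to (T-square⇔ z r) z-root) (≈-sym (Equivalence.to (T-square⇔ y r) y-root))))

  sqrtCount≤1 : ∀ r → + r ≈ + 0 → sqrtCount r ≤ 1
  sqrtCount≤1 r r≈0 = count≤1 p (isSqrtOf r) 0 (λ z z<p z-root → residue-unique z<p 0<p
    (square≈0⇒≈0 (+ z) (≈-trans (Equivalence.to (T-square⇔ z r) z-root) r≈0)))
    where
    square≈0⇒≈0 : ∀ z → z * z ≈ + 0 → z ≈ + 0
    square≈0⇒≈0 z z²≈0 = Sum.[ id , id ] (*≈0⇒≈0⊎≈0 z z z²≈0)

  nonsquare⇒sqrtCount≡0 : ∀ r → ¬ IsSquare (+ r) → sqrtCount r ≡ 0
  nonsquare⇒sqrtCount≡0 r ¬□ with count≡0⊎witness p (isSqrtOf r)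
  ... | inj₁ none = none
  ... | inj₂ (y , y<p , y-root) = contradiction (y , y<p , Equivalence.to (T-square⇔ y r) y-root) ¬□

  ∑sqrtCount≡p : ∑< p sqrtCount ≡ p
  ∑sqrtCount≡p = begin
    ∑< p (λ r → count p (λ y → isSqrtOf r y)) ≡⟨ ∑<-comm p p (λ r y → 𝟙 (isSqrtOf r y)) ⟩
    ∑< p (λ y → count p (λ r → isSqrtOf r y)) ≡⟨ ∑<-cong p (λ y _ → one-square y) ⟩
    ∑< p (const 1)                            ≡⟨ ∑<-const p 1 ⟩
    p ℕ.* 1                                   ≡⟨ ℕ.*-identityʳ p ⟩
    p                                         ∎
    where
    open ≡-Reasoning
    one-square : ∀ y → count p (λ r → isSqrtOf r y) ≡ 1
    one-square y = trans
      (count-cong p {λ r → isSqrtOf r y} {_≡ᵇ (y ℕ.* y) % p} (λ r r<p → mk⇔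
        (λ t → ℕ.≡⇒≡ᵇ r _ (trans (sym (m<n⇒m%n≡m r<p)) (sym (toWitness t))))
        (λ t → fromWitness (trans (sym (ℕ.≡ᵇ⇒≡ r _ t)) (sym (m<n⇒m%n≡m r<p))))))
      (count-≡ᵇ p ((y ℕ.* y) % p) (m%n<n _ p))

  T-onEdwards⇔ : ∀ c x y → T (onEdwards p c (x , y)) ⇔ IsEdwardsPoint (+ c) (+ x) (+ y)
  T-onEdwards⇔ c x y =
    subst₂ (λ l r → T (onEdwards p c (x , y)) ⇔ l ≈ r) pos-lhs pos-rhs (T-%≟%⇔≈ _ _)
    where
    pos-lhs : + (x ℕ.* x ℕ.+ y ℕ.* y) ≡ + x * + x + + y * + y
    pos-lhs = trans (pos-+ (x ℕ.* x) (y ℕ.* y)) (cong₂ _+_ (pos-* x x) (pos-* y y))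
    pos-rhs : + (1 ℕ.+ c ℕ.* (x ℕ.* x) ℕ.* (y ℕ.* y)) ≡ + 1 + + c * (+ x * + x) * (+ y * + y)
    pos-rhs = trans (pos-+ 1 _) (cong (_+_ (+ 1)) (trans (pos-* (c ℕ.* (x ℕ.* x)) (y ℕ.* y))
      (cong₂ _*_ (trans (pos-* c (x ℕ.* x)) (cong (_*_ (+ c)) (pos-* x x))) (pos-* y y))))

  T-onEdwards-swap : ∀ c x y → T (onEdwards p c (x , y)) → T (onEdwards p c (y , x))
  T-onEdwards-swap c x y =
    Equivalence.from (T-onEdwards⇔ c y x) ∘ edwards-swap (+ c) (+ x) (+ y)
      ∘ Equivalence.to (T-onEdwards⇔ c x y)

  T-onEdwards-y≡0⇔ : ∀ c x → T (onEdwards p c (x , 0)) ⇔ + x * + x ≈ + 1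
  T-onEdwards-y≡0⇔ c x = mk⇔
    (edwards-y≡0⇒x²≈1 (+ c) (+ x) ∘ Equivalence.to (T-onEdwards⇔ c x 0))
    (Equivalence.from (T-onEdwards⇔ c x 0) ∘ x²≈1⇒edwards-y≡0 (+ c) (+ x))

  fibre : ℕ → ℕ → ℕ
  fibre c x = count p (λ y → onEdwards p c (x , y))

  edwardsOrder≡∑fibre : ∀ c → edwardsOrder p c ≡ ∑< p (fibre c)
  edwardsOrder≡∑fibre c = length-filter-grid (onEdwards p c) p id p

  fibre-0≡sqrtCount-1 : ∀ c → fibre c 0 ≡ sqrtCount 1
  fibre-0≡sqrtCount-1 c = count-cong p (λ y _ → mk⇔
    (Equivalence.from (T-square⇔ y 1) ∘ Equivalence.to (T-onEdwards-y≡0⇔ c y) ∘ T-onEdwards-swap c 0 y)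
    (T-onEdwards-swap c y 0 ∘ Equivalence.from (T-onEdwards-y≡0⇔ c y) ∘ Equivalence.to (T-square⇔ y 1)))

  onAxis : ℕ → ℕ → ℕ
  onAxis c x = 𝟙 (onEdwards p c (x , 0))

  onAxis-independent : ∀ c c′ x → onAxis c x ≡ onAxis c′ x
  onAxis-independent c c′ x = 𝟙-cong (mk⇔
    (Equivalence.from (T-onEdwards-y≡0⇔ c′ x) ∘ Equivalence.to (T-onEdwards-y≡0⇔ c x))
    (Equivalence.from (T-onEdwards-y≡0⇔ c x) ∘ Equivalence.to (T-onEdwards-y≡0⇔ c′ x)))

  module NonSquareCase (d e : ℕ) (de≈1 : + d * + e ≈ + 1) (nonsquare : ¬ IsSquare (+ d)) where

    ratio-of-roots-is-square : ∀ r y t → 0 < r → r < p → y < p →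
      + y * + y ≈ + r → + t * + t ≈ + d * + r → IsSquare (+ d)
    ratio-of-roots-is-square r y t 0<r r<p y<p y²≈r t²≈dr =
      residue w , residue<p w ,
      ≈-trans (≈-* (residue-≈ w) (residue-≈ w))
        (ratio-square (+ d) (+ r) (+ t) (+ y) (+ inv y) t²≈dr y²≈r (*-inv y 0<y y<p))
      where
      w : ℤ
      w = + t * + inv y
      0<y : 0 < y
      0<y = ℕ.n≢0⇒n>0 λ { refl → ℕ.<⇒≢ 0<r (sym (residue-unique r<p 0<p (≈-sym y²≈r))) }

    sqrtCount-pair≤2 : ∀ r → r < p → sqrtCount r ℕ.+ sqrtCount (scale d r) ≤ 2
    sqrtCount-pair≤2 zero _ = ℕ.+-mono-≤ (sqrtCount≤1 0 ≈-refl)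
      (sqrtCount≤1 (scale d 0) (≈-trans (scale-≈ d 0) (≡⇒≈ (ℤ.*-zeroʳ (+ d)))))
    sqrtCount-pair≤2 r@(suc _) r<p
      with count≡0⊎witness p (isSqrtOf r) | count≡0⊎witness p (isSqrtOf (scale d r))
    ... | inj₁ none | _ rewrite none = sqrtCount≤2 (scale d r)
    ... | inj₂ _ | inj₁ none rewrite none | ℕ.+-identityʳ (sqrtCount r) = sqrtCount≤2 r
    ... | inj₂ (y , y<p , y-root) | inj₂ (t , t<p , t-root) = contradiction
      (ratio-of-roots-is-square r y t (s≤s z≤n) r<p y<p (Equivalence.to (T-square⇔ y r) y-root)
        (≈-trans (Equivalence.to (T-square⇔ t (scale d r)) t-root) (scale-≈ d r)))
      nonsquare

    sqrtCount-pair≡2 : ∀ r → r < p → sqrtCount r ℕ.+ sqrtCount (scale d r) ≡ 2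
    sqrtCount-pair≡2 = ∑<-mono-≤-≡⇒≡ p sqrtCount-pair≤2 (begin
      ∑< p (λ r → sqrtCount r ℕ.+ sqrtCount (scale d r))
        ≡⟨ ∑<-distrib-+ p sqrtCount (sqrtCount ∘ scale d) ⟩
      ∑< p sqrtCount ℕ.+ ∑< p (sqrtCount ∘ scale d)
        ≡⟨ cong (∑< p sqrtCount ℕ.+_) (∑<-scale d e de≈1 sqrtCount) ⟩
      ∑< p sqrtCount ℕ.+ ∑< p sqrtCount
        ≡⟨ cong₂ ℕ._+_ ∑sqrtCount≡p ∑sqrtCount≡p ⟩
      p ℕ.+ p
        ≡⟨ cong (p ℕ.+_) (sym (ℕ.+-identityʳ p)) ⟩
      2 ℕ.* p
        ≡⟨ trans (ℕ.*-comm 2 p) (sym (∑<-const p 2)) ⟩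
      ∑< p (const 2) ∎)
      where open ≡-Reasoning

    sqrtCount-1≡2 : sqrtCount 1 ≡ 2
    sqrtCount-1≡2 = begin
      sqrtCount 1                            ≡⟨ sym (ℕ.+-identityʳ _) ⟩
      sqrtCount 1 ℕ.+ 0                      ≡⟨ cong (sqrtCount 1 ℕ.+_) (sym no-root-of-d) ⟩
      sqrtCount 1 ℕ.+ sqrtCount (scale d 1)  ≡⟨ sqrtCount-pair≡2 1 1<p ⟩
      2                                      ∎
      where
      open ≡-Reasoning
      no-root-of-d : sqrtCount (scale d 1) ≡ 0
      no-root-of-d = nonsquare⇒sqrtCount≡0 (scale d 1) λ (a , a<p , a²≈d·1) →
        nonsquare (a , a<p , ≈-trans a²≈d·1 (≈-trans (scale-≈ d 1) (≡⇒≈ (ℤ.*-identityʳ (+ d)))))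

    module OffAxis (x : ℕ) (0<x : 0 < x) (x<p : x < p) where

      denominator : ℤ
      denominator = + d * (+ x * + x) - + 1

      c : ℕ
      c = residue denominator

      0<c : 0 < c
      0<c = ℕ.n≢0⇒n>0 λ c≡0 → nonsquare (inv x , inv<p x ,
        [dx²≈1]⇒[x⁻¹]²≈d (+ d) (+ x) (+ inv x)
          (≈-trans (≈-sym (residue-≈ denominator)) (≡⇒≈ (cong +_ c≡0)))
          (*-inv x 0<x x<p))

      denominator-inverse : denominator * + inv c ≈ + 1
      denominator-inverse =
        ≈-trans (≈-* (≈-sym (residue-≈ denominator)) ≈-refl) (*-inv c 0<c (residue<p denominator))

      r : ℕ
      r = residue ((+ x * + x - + 1) * + inv c)

      r-≈ : + r ≈ (+ x * + x - + 1) * + inv c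
      r-≈ = residue-≈ ((+ x * + x - + 1) * + inv c)

      fibre≡sqrtCount : fibre d x ≡ sqrtCount r
      fibre≡sqrtCount = count-cong p (λ y _ → mk⇔
        (Equivalence.from (T-square⇔ y r) ∘ (λ y²≈ → ≈-trans y²≈ (≈-sym r-≈))
          ∘ *≈⇒≈*inverse denominator (+ inv c) (+ y * + y) (+ x * + x - + 1) denominator-inverse
          ∘ edwards⇒fibre-equation (+ d) (+ x) (+ y) ∘ Equivalence.to (T-onEdwards⇔ d x y))
        (Equivalence.from (T-onEdwards⇔ d x y) ∘ fibre-equation⇒edwards (+ d) (+ x) (+ y)
          ∘ ≈*inverse⇒*≈ denominator (+ inv c) (+ y * + y) (+ x * + x - + 1) denominator-inverse
          ∘ (λ y²≈r → ≈-trans y²≈r r-≈) ∘ Equivalence.to (T-square⇔ y r)))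

      dr≈ : + scale d r ≈ + d * (+ x * + x - + 1) * + inv c
      dr≈ = ≈-trans (scale-≈ d r) (≈-trans (≈-* (≈-refl {+ d}) r-≈)
        (≡⇒≈ (sym (ℤ.*-assoc (+ d) (+ x * + x - + 1) (+ inv c)))))

      fibre-inv≡sqrtCount : fibre e (inv x) ≡ sqrtCount (scale d r)
      fibre-inv≡sqrtCount = count-cong p (λ t _ → mk⇔
        (Equivalence.from (T-square⇔ t (scale d r)) ∘ (λ t²≈ → ≈-trans t²≈ (≈-sym dr≈))
          ∘ *≈⇒≈*inverse denominator (+ inv c) (+ t * + t) (+ d * (+ x * + x - + 1)) denominator-inverse
          ∘ edwards-inverse⇒fibre-equation (+ d) (+ e) (+ x) (+ inv x) (+ t) (*-inv x 0<x x<p) de≈1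
          ∘ Equivalence.to (T-onEdwards⇔ e (inv x) t))
        (Equivalence.from (T-onEdwards⇔ e (inv x) t)
          ∘ fibre-equation⇒edwards-inverse (+ d) (+ e) (+ x) (+ inv x) (+ t) (*-inv x 0<x x<p) de≈1
          ∘ ≈*inverse⇒*≈ denominator (+ inv c) (+ t * + t) (+ d * (+ x * + x - + 1)) denominator-inverse
          ∘ (λ t²≈ → ≈-trans t²≈ dr≈) ∘ Equivalence.to (T-square⇔ t (scale d r))))

      fibre-pair≡2 : fibre d x ℕ.+ fibre e (inv x) ≡ 2
      fibre-pair≡2 = trans (cong₂ ℕ._+_ fibre≡sqrtCount fibre-inv≡sqrtCount)
                           (sqrtCount-pair≡2 r (residue<p ((+ x * + x - + 1) * + inv c)))

    order-sum : edwardsOrder p d ℕ.+ edwardsOrder p e ≡ 2 ℕ.* p ℕ.+ 2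
    order-sum = ℕ.+-cancelʳ-≡ 2 _ _ (begin
      edwardsOrder p d ℕ.+ edwardsOrder p e ℕ.+ 2
        ≡⟨ cong₂ (λ m n → m ℕ.+ n ℕ.+ 2) (edwardsOrder≡∑fibre d)
                 (trans (edwardsOrder≡∑fibre e) (sym (∑<-inv (fibre e)))) ⟩
      ∑< p (fibre d) ℕ.+ ∑< p (fibre e ∘ inv) ℕ.+ 2
        ≡⟨ cong (λ n → n ℕ.+ 2) (sym (∑<-distrib-+ p (fibre d) (fibre e ∘ inv))) ⟩
      ∑< p (λ x → fibre d x ℕ.+ fibre e (inv x)) ℕ.+ 2
        ≡⟨ ∑<-agree-off-0 p _ (const 2) 0<p OffAxis.fibre-pair≡2 ⟩
      ∑< p (const 2) ℕ.+ (fibre d 0 ℕ.+ fibre e 0)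
        ≡⟨ cong₂ ℕ._+_ (∑<-const p 2)
                 (cong₂ ℕ._+_ (fibre-0≡sqrtCount-1 d) (fibre-0≡sqrtCount-1 e)) ⟩
      p ℕ.* 2 ℕ.+ (sqrtCount 1 ℕ.+ sqrtCount 1)
        ≡⟨ cong (λ k → p ℕ.* 2 ℕ.+ (k ℕ.+ k)) sqrtCount-1≡2 ⟩
      p ℕ.* 2 ℕ.+ 4
        ≡⟨ arithmetic p ⟩
      2 ℕ.* p ℕ.+ 2 ℕ.+ 2 ∎)
      where
      open ≡-Reasoning
      arithmetic : ∀ n → n ℕ.* 2 ℕ.+ 4 ≡ 2 ℕ.* n ℕ.+ 2 ℕ.+ 2
      arithmetic = ℕ-Solver.solve-∀

  module SquareCase (d e : ℕ) (de≈1 : + d * + e ≈ + 1) (a : ℕ) (a²≈d : + a * + a ≈ + d) where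

    a⁻¹ : ℕ
    a⁻¹ = scale a e

    aa⁻¹≈1 : + a * + a⁻¹ ≈ + 1
    aa⁻¹≈1 = ≈-trans (≈-* (≈-refl {+ a}) (scale-≈ a e)) (root-inverse (+ a) (+ d) (+ e) a²≈d de≈1)

    [a⁻¹]²≈e : + a⁻¹ * + a⁻¹ ≈ + e
    [a⁻¹]²≈e =
      ≈-trans (≈-* (scale-≈ a e) (scale-≈ a e)) (root-inverse-square (+ a) (+ d) (+ e) a²≈d de≈1)

    ed≈1 : + e * + d ≈ + 1
    ed≈1 = ≈-trans (≡⇒≈ (ℤ.*-comm (+ e) (+ d))) de≈1

    twist⇔ : ∀ x y → 0 < y → y < p → T (onEdwards p d (x , inv y)) ⇔ T (onEdwards p e (scale a x , y))
    twist⇔ x y 0<y y<p = mk⇔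
      (Equivalence.from (T-onEdwards⇔ e (scale a x) y)
        ∘ edwards-twist (+ d) (+ e) (+ a) (+ x) (+ inv y) (+ scale a x) (+ y)
            de≈1 a²≈d (scale-≈ a x) (*-inv y 0<y y<p)
        ∘ Equivalence.to (T-onEdwards⇔ d x (inv y)))
      (Equivalence.from (T-onEdwards⇔ d x (inv y))
        ∘ edwards-twist (+ e) (+ d) (+ a⁻¹) (+ scale a x) (+ y) (+ x) (+ inv y)
            ed≈1 [a⁻¹]²≈e x≈a⁻¹ax y⁻¹y≈1
        ∘ Equivalence.to (T-onEdwards⇔ e (scale a x) y))
      where
      x≈a⁻¹ax : + x ≈ + a⁻¹ * + scale a x
      x≈a⁻¹ax = ≈-sym (≈-trans (≈-* (≈-refl {+ a⁻¹}) (scale-≈ a x))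
                                (unit-cancel (+ a) (+ a⁻¹) (+ x) aa⁻¹≈1))
      y⁻¹y≈1 : + inv y * + y ≈ + 1
      y⁻¹y≈1 = ≈-trans (≡⇒≈ (ℤ.*-comm (+ inv y) (+ y))) (*-inv y 0<y y<p)

    fibre-twist : ∀ x → fibre d x ℕ.+ onAxis e (scale a x) ≡ fibre e (scale a x) ℕ.+ onAxis d x
    fibre-twist x = begin
      fibre d x ℕ.+ onAxis e (scale a x)
        ≡⟨ cong (λ n → n ℕ.+ onAxis e (scale a x))
                (sym (∑<-inv (λ y → 𝟙 (onEdwards p d (x , y))))) ⟩
      ∑< p (λ y → 𝟙 (onEdwards p d (x , inv y))) ℕ.+ onAxis e (scale a x)
        ≡⟨ ∑<-agree-off-0 p _ _ 0<p (λ y 0<y y<p → 𝟙-cong (twist⇔ x y 0<y y<p)) ⟩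
      fibre e (scale a x) ℕ.+ onAxis d x ∎
      where open ≡-Reasoning

    order-equal : edwardsOrder p d ≡ edwardsOrder p e
    order-equal = ℕ.+-cancelʳ-≡ (∑< p (onAxis d)) _ _ (begin
      edwardsOrder p d ℕ.+ ∑< p (onAxis d)
        ≡⟨ cong₂ ℕ._+_ (edwardsOrder≡∑fibre d) axis-sums ⟩
      ∑< p (fibre d) ℕ.+ ∑< p (onAxis e ∘ scale a)
        ≡⟨ sym (∑<-distrib-+ p (fibre d) (onAxis e ∘ scale a)) ⟩
      ∑< p (λ x → fibre d x ℕ.+ onAxis e (scale a x))
        ≡⟨ ∑<-cong p (λ x _ → fibre-twist x) ⟩
      ∑< p (λ x → fibre e (scale a x) ℕ.+ onAxis d x)
        ≡⟨ ∑<-distrib-+ p (fibre e ∘ scale a) (onAxis d) ⟩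
      ∑< p (fibre e ∘ scale a) ℕ.+ ∑< p (onAxis d)
        ≡⟨ cong (λ n → n ℕ.+ ∑< p (onAxis d))
                (trans (∑<-scale a a⁻¹ aa⁻¹≈1 (fibre e)) (sym (edwardsOrder≡∑fibre e))) ⟩
      edwardsOrder p e ℕ.+ ∑< p (onAxis d) ∎)
      where
      open ≡-Reasoning
      axis-sums : ∑< p (onAxis d) ≡ ∑< p (onAxis e ∘ scale a)
      axis-sums = sym (trans (∑<-scale a a⁻¹ aa⁻¹≈1 (onAxis e))
                             (∑<-cong p (λ x _ → onAxis-independent e d x)))

open import Data.Nat using (_+_; _*_)

theorem5 : (p : ℕ) .{{_ : NonZero p}} → Prime p → p ≢ 2 →
    (d d⁻¹ : ℕ) → d < p → d⁻¹ < p → d ≢ 0 → d ≢ 1 → (d * d⁻¹) % p ≡ 1 →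
    (legendre p d ≡ + 1 → edwardsOrder p d ≡ edwardsOrder p d⁻¹)
    × (legendre p d ≡ -[1+ 0 ] → edwardsOrder p d + edwardsOrder p d⁻¹ ≡ 2 * p + 2)
theorem5 p p-prime _ d d⁻¹ _ _ _ _ dd⁻¹%p≡1 = square , nonsquare
  where
  open EdwardsCurves p p-prime
  square : legendre p d ≡ + 1 → edwardsOrder p d ≡ edwardsOrder p d⁻¹
  square symbol≡1 with a , _ , a²≈d ← legendre≡1⇒square d symbol≡1 =
    SquareCase.order-equal d d⁻¹ (*%≡1⇒*≈1 d d⁻¹ dd⁻¹%p≡1) a a²≈d
  nonsquare : legendre p d ≡ -[1+ 0 ] → edwardsOrder p d + edwardsOrder p d⁻¹ ≡ 2 * p + 2
  nonsquare symbol≡-1 =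
    NonSquareCase.order-sum d d⁻¹ (*%≡1⇒*≈1 d d⁻¹ dd⁻¹%p≡1) (legendre≡-1⇒nonsquare d symbol≡-1)
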